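{- Let $k\ge 3$ and $n$ be integers with $n-k\ge 1$, and let $G=L(S(CS_{k,n-k}))$ be the line graph of the subdivision graph of the cycle-star graph $CS_{k,n-k}$. Then $$\overline{M_1}(G)=n^3+(3-k)n^2-(k^2-12k+18)n+k^3-7k^2+6k.$$
   Context: All graphs are finite and simple; $d_G(v)$ denotes the degree of vertex $v$ in $G$. The cycle-star graph $CS_{k,n-k}$ is the graph on $n$ vertices consisting of a cycle of length $k$ together with $n-k$ leaf (pendant) vertices, all attached to the same vertex of the cycle. The subdivision graph $S(H)$ of a graph $H$ is obtained by replacing each edge of $H$ by a path of length 2. The line graph $L(H)$ has the edges of $H$ as vertices, two being adjacent iff the corresponding edges share an endpoint. The first Zagreb coindex is $\overline{M_1}(G)=\sum [d_G(u)+d_G(v)]$, the sum taken over all unordered pairs $\{u,v\}$ of distinct vertices $u\neq v$ of $G$ with $uv\notin E(G)$. -}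

module Defs where

open import Data.Bool using (Bool; true; false; if_then_else_; _∧_; _∨_; not)
open import Data.Nat using (ℕ; zero; suc; _+_; _≡ᵇ_; _<ᵇ_)
open import Data.List using (List; []; _∷_; _++_; map; concatMap; length; upTo; zip)
open import Data.Nat.ListAction using (sum)
open import Data.Product using (_×_; _,_)

-- A finite simple graph with vertex set {0, …, order-1} given by its
-- list of edges (each edge an unordered pair written as an ordered pair).
record Graph : Set where
  constructor mkGraph
  field
    order : ℕ
    edges : List (ℕ × ℕ)
open Graph public

adj : Graph → ℕ → ℕ → Bool
adj G u v = go (edges G)
  where
  go : List (ℕ × ℕ) → Bool
  go [] = false
  go ((a , b) ∷ es) = ((a ≡ᵇ u) ∧ (b ≡ᵇ v)) ∨ ((a ≡ᵇ v) ∧ (b ≡ᵇ u)) ∨ go es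

deg : Graph → ℕ → ℕ
deg G v = sum (map (λ u → if adj G u v then 1 else 0) (upTo (order G)))

pairs : ℕ → List (ℕ × ℕ)
pairs n = concatMap (λ v → map (λ u → (u , v)) (upTo v)) (upTo n)

coM1 : Graph → ℕ
coM1 G = sum (map f (pairs (order G)))
  where
  f : ℕ × ℕ → ℕ
  f (u , v) = if adj G u v then 0 else deg G u + deg G v

indexed : List (ℕ × ℕ) → List (ℕ × (ℕ × ℕ))
indexed E = zip (upTo (length E)) E

-- cycle-star graph CS_{k,m}: cycle 0-1-…-(k-1)-0, and m pendant vertices
-- k, …, k+m-1 all attached to cycle vertex 0
cycleNext : ℕ → ℕ → ℕ
cycleNext k i = if suc i ≡ᵇ k then 0 else suc i

CS : ℕ → ℕ → Graph
CS k m = mkGraph (k + m)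
  (map (λ i → (i , cycleNext k i)) (upTo k) ++ map (λ j → (0 , k + j)) (upTo m))

-- subdivision graph S(H): the i-th edge ab is replaced by the path a – (n+i) – b
S : Graph → Graph
S H = mkGraph (order H + length (edges H))
  (concatMap (λ { (i , (a , b)) → (a , order H + i) ∷ (b , order H + i) ∷ [] })
             (indexed (edges H)))

share : ℕ × ℕ → ℕ × ℕ → Bool
share (a , b) (c , d) = (a ≡ᵇ c) ∨ (a ≡ᵇ d) ∨ (b ≡ᵇ c) ∨ (b ≡ᵇ d)

-- line graph L(H): vertex i is the i-th edge of H; distinct edges i < j
-- are adjacent iff they share an endpoint
L : Graph → Graph
L H = mkGraph (length (edges H))
  (concatMap (λ { (j , f) → concatMap (λ { (i , e) →
       if (i <ᵇ j) ∧ share e f then (i , j) ∷ [] else [] }) (indexed (edges H)) })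
     (indexed (edges H)))

{-# OPTIONS --safe #-}
module Submission where

-- The vertices of L(S(H)) are the half-edges (v, e) of H, v an end of e, and two of them are
-- adjacent iff they share v or e; so the half-edge at v has degree d_H(v).  For H = CS_{k,m}
-- (m = n - k) this gives m + 2 vertices of degree m + 2, 2(k - 1) of degree 2 and m of
-- degree 1.  The coindex of a graph only depends on its degrees: summing d_u + d_v over all
-- pairs and removing the adjacent ones gives coM1(G) = (|V| - 1) ∑ d_v - ∑ d_v², and
-- |V(G)| = 2n turns this into the stated cubic.

open import Defs

module Counting where
  open import Data.Bool using (Bool; true; false; if_then_else_)
  open import Data.List using (List; []; _∷_; _++_; map; concatMap; applyUpTo)
  open import Data.List.Properties using (map-++)
  open import Data.Nat using (ℕ; zero; suc; _+_; _*_; _≤_; _<_; _≡ᵇ_; _≟_; s≤s)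
  open import Data.Nat.ListAction using (sum)
  open import Data.Nat.ListAction.Properties using (sum-++)
  open import Data.Nat.Properties
  open import Algebra.Properties.CommutativeSemigroup +-commutativeSemigroup using (interchange)
  open import Data.Nat.Tactic.RingSolver using (solve-∀)
  open import Data.Sum using (inj₁; inj₂)
  open import Relation.Binary.PropositionalEquality
  open import Relation.Nullary.Decidable using (dec-true; dec-false)
  open ≡-Reasoning

  ≡ᵇ-refl : ∀ n → (n ≡ᵇ n) ≡ true
  ≡ᵇ-refl n = dec-true (n ≟ n) refl

  ≢⇒≡ᵇ-false : ∀ {m n} → m ≢ n → (m ≡ᵇ n) ≡ false
  ≢⇒≡ᵇ-false {m} {n} = dec-false (m ≟ n)

  ≡ᵇ-sym : ∀ m n → (m ≡ᵇ n) ≡ (n ≡ᵇ m)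
  ≡ᵇ-sym zero    zero    = refl
  ≡ᵇ-sym zero    (suc n) = refl
  ≡ᵇ-sym (suc m) zero    = refl
  ≡ᵇ-sym (suc m) (suc n) = ≡ᵇ-sym m n

  +-cancelˡ-≡ᵇ : ∀ k m n → (k + m ≡ᵇ k + n) ≡ (m ≡ᵇ n)
  +-cancelˡ-≡ᵇ zero    m n = refl
  +-cancelˡ-≡ᵇ (suc k) m n = +-cancelˡ-≡ᵇ k m n

  ⟦_⟧ : Bool → ℕ
  ⟦ b ⟧ = if b then 1 else 0

  ∑ : ℕ → (ℕ → ℕ) → ℕ
  ∑ zero    f = 0
  ∑ (suc n) f = ∑ n f + f n

  syntax ∑ n (λ i → e) = ∑[ i < n ] e

  ∑-cong : ∀ n {f g : ℕ → ℕ} → (∀ i → i < n → f i ≡ g i) → ∑ n f ≡ ∑ n g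
  ∑-cong zero    f≗g = refl
  ∑-cong (suc n) f≗g = cong₂ _+_ (∑-cong n (λ i i<n → f≗g i (m<n⇒m<1+n i<n))) (f≗g n (n<1+n n))

  ∑-+ : ∀ n (f g : ℕ → ℕ) → ∑[ i < n ] (f i + g i) ≡ ∑ n f + ∑ n g
  ∑-+ zero    f g = refl
  ∑-+ (suc n) f g =
    trans (cong (_+ (f n + g n)) (∑-+ n f g)) (interchange (∑ n f) (∑ n g) (f n) (g n))

  ∑∑-+ : ∀ n (F G : ℕ → ℕ → ℕ) →
    ∑[ v < n ] ∑[ u < v ] (F u v + G u v)
      ≡ ∑[ v < n ] ∑[ u < v ] F u v + ∑[ v < n ] ∑[ u < v ] G u v
  ∑∑-+ n F G = trans (∑-cong n (λ v _ → ∑-+ v (λ u → F u v) (λ u → G u v))) (∑-+ n _ _)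

  ∑-const : ∀ n c → ∑[ i < n ] c ≡ n * c
  ∑-const zero    c = refl
  ∑-const (suc n) c = trans (cong (_+ c) (∑-const n c)) (+-comm (n * c) c)

  ∑-*ʳ : ∀ n (f : ℕ → ℕ) c → ∑[ i < n ] (f i * c) ≡ ∑ n f * c
  ∑-*ʳ zero    f c = refl
  ∑-*ʳ (suc n) f c = trans (cong (_+ f n * c) (∑-*ʳ n f c)) (sym (*-distribʳ-+ c (∑ n f) (f n)))

  ∑-suc : ∀ n (f : ℕ → ℕ) → ∑ (suc n) f ≡ f 0 + ∑[ i < n ] f (suc i)
  ∑-suc zero    f = +-comm 0 (f 0)
  ∑-suc (suc n) f = trans (cong (_+ f (suc n)) (∑-suc n f)) (+-assoc (f 0) _ _)

  ∑-split : ∀ m n (f : ℕ → ℕ) → ∑ (m + n) f ≡ ∑ m f + ∑[ i < n ] f (m + i)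
  ∑-split m zero    f = trans (cong (λ k → ∑ k f) (+-identityʳ m)) (sym (+-identityʳ _))
  ∑-split m (suc n) f = begin
    ∑ (m + suc n) f                           ≡⟨ cong (λ k → ∑ k f) (+-suc m n) ⟩
    ∑ (m + n) f + f (m + n)                    ≡⟨ cong (_+ f (m + n)) (∑-split m n f) ⟩
    ∑ m f + ∑[ i < n ] f (m + i) + f (m + n)   ≡⟨ +-assoc (∑ m f) _ _ ⟩
    ∑ m f + ∑[ i < suc n ] f (m + i)           ∎

  ∑-⟦≡ᵇ⟧-≥ : ∀ n {a} → n ≤ a → ∑[ i < n ] ⟦ i ≡ᵇ a ⟧ ≡ 0
  ∑-⟦≡ᵇ⟧-≥ zero    _   = refl
  ∑-⟦≡ᵇ⟧-≥ (suc n) n<a = cong₂ _+_ (∑-⟦≡ᵇ⟧-≥ n (<⇒≤ n<a)) (cong ⟦_⟧ (≢⇒≡ᵇ-false (<⇒≢ n<a)))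

  ∑-⟦≡ᵇ⟧-< : ∀ n {a} → a < n → ∑[ i < n ] ⟦ i ≡ᵇ a ⟧ ≡ 1
  ∑-⟦≡ᵇ⟧-< (suc n) (s≤s a≤n) with m≤n⇒m<n∨m≡n a≤n
  ... | inj₁ a<n  = cong₂ _+_ (∑-⟦≡ᵇ⟧-< n a<n) (cong ⟦_⟧ (≢⇒≡ᵇ-false (>⇒≢ a<n)))
  ... | inj₂ refl = cong₂ _+_ (∑-⟦≡ᵇ⟧-≥ n ≤-refl) (cong ⟦_⟧ (≡ᵇ-refl n))

  ∑-square-split : ∀ n (F : ℕ → ℕ → ℕ) →
    ∑[ v < n ] ∑[ u < v ] F u v + ∑[ v < n ] F v v + ∑[ v < n ] ∑[ u < v ] F v u
      ≡ ∑[ v < n ] ∑[ u < n ] F u v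
  ∑-square-split zero    F = refl
  ∑-square-split (suc n) F = begin
    (lower + column) + (diagonal + F n n) + (upper + row)
      ≡⟨ regroup lower column diagonal (F n n) upper row ⟩
    (lower + diagonal + upper) + row + (column + F n n)
      ≡⟨ cong (λ s → s + row + (column + F n n)) (∑-square-split n F) ⟩
    ∑[ v < n ] ∑[ u < n ] F u v + row + (column + F n n)
      ≡⟨ cong (_+ (column + F n n)) (∑-+ n _ _) ⟨
    ∑[ v < suc n ] ∑[ u < suc n ] F u v ∎
    where
    lower upper diagonal row column : ℕ
    lower    = ∑[ v < n ] ∑[ u < v ] F u v
    upper    = ∑[ v < n ] ∑[ u < v ] F v u
    diagonal = ∑[ v < n ] F v v
    row      = ∑[ v < n ] F n v
    column   = ∑[ u < n ] F u n
    regroup : ∀ a b c d e f → (a + b) + (c + d) + (e + f) ≡ (a + c + e) + f + (b + d)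
    regroup = solve-∀

  sum-map-applyUpTo : ∀ n (f g : ℕ → ℕ) → sum (map f (applyUpTo g n)) ≡ ∑[ i < n ] f (g i)
  sum-map-applyUpTo zero    f g = refl
  sum-map-applyUpTo (suc n) f g =
    trans (cong (f (g 0) +_) (sum-map-applyUpTo n f (λ i → g (suc i))))
          (sym (∑-suc n (λ i → f (g i))))

  sum-concatMap : ∀ {A B : Set} (f : B → ℕ) (g : A → List B) xs →
    sum (map f (concatMap g xs)) ≡ sum (map (λ x → sum (map f (g x))) xs)
  sum-concatMap f g []       = refl
  sum-concatMap f g (x ∷ xs) = begin
    sum (map f (g x ++ concatMap g xs))               ≡⟨ cong sum (map-++ f (g x) _) ⟩
    sum (map f (g x) ++ map f (concatMap g xs))       ≡⟨ sum-++ (map f (g x)) _ ⟩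
    sum (map f (g x)) + sum (map f (concatMap g xs))  ≡⟨ cong (sum (map f (g x)) +_) (sum-concatMap f g xs) ⟩
    sum (map (λ x → sum (map f (g x))) (x ∷ xs))      ∎

module Graphs where
  open Counting
  open import Data.Bool using (Bool; true; false; if_then_else_; _∧_; _∨_)
  open import Data.Bool.ListAction using (any; or)
  open import Data.Bool.Properties using (∨-assoc; ∨-comm)
  open import Data.List using ([]; _∷_; map; upTo)
  open import Data.List.Properties using (map-cong; map-∘)
  open import Data.Nat using (ℕ; _+_; _*_; _<_; _≡ᵇ_)
  open import Data.Nat.ListAction using (sum)
  open import Data.Nat.Properties
    using (+-identityʳ; +-comm; *-zeroʳ; *-distribˡ-+; +-commutativeSemigroup)
  open import Algebra.Properties.CommutativeSemigroup +-commutativeSemigroup using (xy∙z≈xz∙y)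
  open import Data.Product using (_×_; _,_)
  open import Relation.Binary.PropositionalEquality
  open ≡-Reasoning

  joins : ℕ → ℕ → ℕ × ℕ → Bool
  joins u v (a , b) = ((a ≡ᵇ u) ∧ (b ≡ᵇ v)) ∨ ((a ≡ᵇ v) ∧ (b ≡ᵇ u))

  adj≡any-joins : ∀ n es u v → adj (mkGraph n es) u v ≡ any (joins u v) es
  adj≡any-joins n []             u v = refl
  adj≡any-joins n ((a , b) ∷ es) u v =
    trans (cong (λ r → ((a ≡ᵇ u) ∧ (b ≡ᵇ v)) ∨ ((a ≡ᵇ v) ∧ (b ≡ᵇ u)) ∨ r) (adj≡any-joins n es u v))
          (sym (∨-assoc ((a ≡ᵇ u) ∧ (b ≡ᵇ v)) ((a ≡ᵇ v) ∧ (b ≡ᵇ u)) (any (joins u v) es)))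

  joins-sym : ∀ u v e → joins u v e ≡ joins v u e
  joins-sym u v (a , b) = ∨-comm ((a ≡ᵇ u) ∧ (b ≡ᵇ v)) ((a ≡ᵇ v) ∧ (b ≡ᵇ u))

  adj-sym : ∀ G u v → adj G u v ≡ adj G v u
  adj-sym G u v = begin
    adj G u v                  ≡⟨ adj≡any-joins (order G) (edges G) u v ⟩
    any (joins u v) (edges G)  ≡⟨ cong or (map-cong (joins-sym u v) (edges G)) ⟩
    any (joins v u) (edges G)  ≡⟨ adj≡any-joins (order G) (edges G) v u ⟨
    adj G v u                  ∎

  Loopless : Graph → Set
  Loopless G = ∀ v → v < order G → adj G v v ≡ false

  degSum M1 : Graph → ℕ
  degSum G = ∑[ v < order G ] deg G v
  M1     G = ∑[ v < order G ] (deg G v * deg G v)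

  deg≡∑ : ∀ G v → deg G v ≡ ∑[ u < order G ] ⟦ adj G u v ⟧
  deg≡∑ G v = sum-map-applyUpTo (order G) _ (λ u → u)

  sum-map-pairs : ∀ n (f : ℕ × ℕ → ℕ) → sum (map f (pairs n)) ≡ ∑[ v < n ] ∑[ u < v ] f (u , v)
  sum-map-pairs n f = begin
    sum (map f (pairs n))
      ≡⟨ sum-concatMap f _ (upTo n) ⟩
    sum (map (λ v → sum (map f (map (λ u → (u , v)) (upTo v)))) (upTo n))
      ≡⟨ sum-map-applyUpTo n _ (λ v → v) ⟩
    ∑[ v < n ] sum (map f (map (λ u → (u , v)) (upTo v)))
      ≡⟨ ∑-cong n (λ v _ → trans (sym (cong sum (map-∘ (upTo v)))) (sum-map-applyUpTo v _ (λ u → u))) ⟩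
    ∑[ v < n ] ∑[ u < v ] f (u , v) ∎

  if-then-0+⟦⟧*≡ : ∀ b x → (if b then 0 else x) + ⟦ b ⟧ * x ≡ x
  if-then-0+⟦⟧*≡ true  x = +-identityʳ x
  if-then-0+⟦⟧*≡ false x = +-identityʳ x

  module _ (G : Graph) where
    private
      n = order G
      d = deg G
      a = adj G

    ∑-adjacent-pairs≡M1 : Loopless G → ∑[ v < n ] ∑[ u < v ] (⟦ a u v ⟧ * (d u + d v)) ≡ M1 G
    ∑-adjacent-pairs≡M1 loopless = begin
      ∑[ v < n ] ∑[ u < v ] (⟦ a u v ⟧ * (d u + d v))
        ≡⟨ ∑-cong n (λ v _ → ∑-cong v (λ u _ → split u v)) ⟩
      ∑[ v < n ] ∑[ u < v ] (F v u + F u v)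
        ≡⟨ ∑∑-+ n (λ u v → F v u) F ⟩
      upper + lower
        ≡⟨ +-comm upper lower ⟩
      lower + upper
        ≡⟨ cong (_+ upper) (trans (cong (lower +_) diagonal≡0) (+-identityʳ lower)) ⟨
      lower + ∑[ v < n ] F v v + upper
        ≡⟨ ∑-square-split n F ⟩
      ∑[ v < n ] ∑[ u < n ] F u v
        ≡⟨ ∑-cong n (λ v _ → trans (∑-*ʳ n (λ u → ⟦ a u v ⟧) (d v)) (sym (cong (_* d v) (deg≡∑ G v)))) ⟩
      M1 G ∎
      where
      F : ℕ → ℕ → ℕ
      F u v = ⟦ a u v ⟧ * d v
      lower upper : ℕ
      lower = ∑[ v < n ] ∑[ u < v ] F u v
      upper = ∑[ v < n ] ∑[ u < v ] F v u
      split : ∀ u v → ⟦ a u v ⟧ * (d u + d v) ≡ F v u + F u v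
      split u v = trans (*-distribˡ-+ ⟦ a u v ⟧ (d u) (d v))
                        (cong (λ b → ⟦ b ⟧ * d u + F u v) (adj-sym G u v))
      diagonal≡0 : ∑[ v < n ] F v v ≡ 0
      diagonal≡0 = trans (∑-cong n (λ v v<n → cong (λ b → ⟦ b ⟧ * d v) (loopless v v<n)))
                         (trans (∑-const n 0) (*-zeroʳ n))

    ∑-pairs+degSum≡order*degSum : ∑[ v < n ] ∑[ u < v ] (d u + d v) + degSum G ≡ n * degSum G
    ∑-pairs+degSum≡order*degSum = begin
      ∑[ v < n ] ∑[ u < v ] (d u + d v) + degSum G
        ≡⟨ cong (_+ degSum G) (∑∑-+ n (λ u v → d u) (λ u v → d v)) ⟩
      lower + upper + degSum G
        ≡⟨ xy∙z≈xz∙y lower upper (degSum G) ⟩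
      lower + degSum G + upper
        ≡⟨ ∑-square-split n (λ u v → d u) ⟩
      ∑[ v < n ] degSum G
        ≡⟨ ∑-const n (degSum G) ⟩
      n * degSum G ∎
      where
      lower upper : ℕ
      lower = ∑[ v < n ] ∑[ u < v ] d u
      upper = ∑[ v < n ] ∑[ u < v ] d v

    coM1+M1+degSum≡order*degSum : Loopless G → coM1 G + M1 G + degSum G ≡ order G * degSum G
    coM1+M1+degSum≡order*degSum loopless = begin
      coM1 G + M1 G + degSum G
        ≡⟨ cong₂ (λ c m → c + m + degSum G) (sum-map-pairs n _) (sym (∑-adjacent-pairs≡M1 loopless)) ⟩
      nonAdjacent + adjacent + degSum G
        ≡⟨ cong (_+ degSum G) (∑∑-+ n _ _) ⟨
      ∑[ v < n ] ∑[ u < v ] ((if a u v then 0 else d u + d v) + ⟦ a u v ⟧ * (d u + d v)) + degSum G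
        ≡⟨ cong (_+ degSum G) (∑-cong n (λ v _ → ∑-cong v (λ u _ → if-then-0+⟦⟧*≡ (a u v) (d u + d v)))) ⟩
      ∑[ v < n ] ∑[ u < v ] (d u + d v) + degSum G
        ≡⟨ ∑-pairs+degSum≡order*degSum ⟩
      n * degSum G ∎
      where
      nonAdjacent adjacent : ℕ
      nonAdjacent = ∑[ v < n ] ∑[ u < v ] (if a u v then 0 else d u + d v)
      adjacent    = ∑[ v < n ] ∑[ u < v ] (⟦ a u v ⟧ * (d u + d v))

module EdgeLists where
  open import Data.List using (List; []; _∷_; _++_; length; map; applyUpTo; upTo)
  open import Data.List.Properties using (length-map; length-upTo; map-upTo)
  open import Data.Nat using (ℕ; zero; suc; _+_; _<_; s≤s)
  open import Data.Product using (_×_; _,_)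
  open import Relation.Binary.PropositionalEquality

  _!_ : List (ℕ × ℕ) → ℕ → ℕ × ℕ
  []       ! i     = (0 , 0)
  (e ∷ es) ! zero  = e
  (e ∷ es) ! suc i = es ! i

  !-++ˡ : ∀ xs ys {i} → i < length xs → (xs ++ ys) ! i ≡ xs ! i
  !-++ˡ (x ∷ xs) ys {zero}  _         = refl
  !-++ˡ (x ∷ xs) ys {suc i} (s≤s i<n) = !-++ˡ xs ys i<n

  !-++ʳ : ∀ xs ys i → (xs ++ ys) ! (length xs + i) ≡ ys ! i
  !-++ʳ []       ys i = refl
  !-++ʳ (x ∷ xs) ys i = !-++ʳ xs ys i

  applyUpTo-! : ∀ (f : ℕ → ℕ × ℕ) {n i} → i < n → applyUpTo f n ! i ≡ f i
  applyUpTo-! f {suc n} {zero}  _         = refl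
  applyUpTo-! f {suc n} {suc i} (s≤s i<n) = applyUpTo-! (λ j → f (suc j)) i<n

  map-upTo-! : ∀ (f : ℕ → ℕ × ℕ) {n i} → i < n → map f (upTo n) ! i ≡ f i
  map-upTo-! f {n} i<n = trans (cong (_! _) (map-upTo f n)) (applyUpTo-! f i<n)

  length-map-upTo : ∀ {A : Set} (f : ℕ → A) n → length (map f (upTo n)) ≡ n
  length-map-upTo f n = trans (length-map f (upTo n)) (length-upTo n)

module LineGraphs where
  open Counting using (≡ᵇ-refl; ≡ᵇ-sym)
  open EdgeLists using (_!_)
  open Graphs using (joins; adj≡any-joins; Loopless)
  open import Data.Bool using (Bool; true; false; if_then_else_; _∧_; _∨_; not)
  open import Data.Bool.ListAction using (any)
  open import Data.Bool.Properties using (∨-assoc; ∨-identityʳ; ∧-distribʳ-∨)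
  open import Data.Bool.Solver using (module ∨-∧-Solver)
  open import Data.List using (List; []; _∷_; _++_; concatMap; applyUpTo; zip; length)
  open import Data.Nat using (ℕ; zero; suc; _<_; _≡ᵇ_; _<ᵇ_; s≤s)
  open import Data.Product using (_×_; _,_)
  open import Relation.Binary.PropositionalEquality
  open ≡-Reasoning

  ⋁ : ℕ → (ℕ → Bool) → Bool
  ⋁ zero    p = false
  ⋁ (suc n) p = p 0 ∨ ⋁ n (λ i → p (suc i))

  syntax ⋁ n (λ i → b) = ⋁[ i < n ] b

  ⋁-cong : ∀ n {p q : ℕ → Bool} → (∀ i → p i ≡ q i) → ⋁ n p ≡ ⋁ n q
  ⋁-cong zero    p≗q = refl
  ⋁-cong (suc n) p≗q = cong₂ _∨_ (p≗q 0) (⋁-cong n (λ i → p≗q (suc i)))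

  ⋁-false : ∀ n → ⋁[ i < n ] false ≡ false
  ⋁-false zero    = refl
  ⋁-false (suc n) = ⋁-false n

  ⋁-∨ : ∀ n (p q : ℕ → Bool) → ⋁[ i < n ] (p i ∨ q i) ≡ ⋁ n p ∨ ⋁ n q
  ⋁-∨ zero    p q = refl
  ⋁-∨ (suc n) p q = trans (cong ((p 0 ∨ q 0) ∨_) (⋁-∨ n _ _)) (interchange (p 0) (q 0) _ _)
    where
    open ∨-∧-Solver
    interchange : ∀ a b c d → (a ∨ b) ∨ (c ∨ d) ≡ (a ∨ c) ∨ (b ∨ d)
    interchange = solve 4 (λ a b c d → (a :+ b) :+ (c :+ d) := (a :+ c) :+ (b :+ d)) refl

  ⋁-select : ∀ n {u} (p : ℕ → Bool) → u < n → ⋁[ i < n ] ((i ≡ᵇ u) ∧ p i) ≡ p u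
  ⋁-select (suc n) {zero}  p _         = trans (cong (p 0 ∨_) (⋁-false n)) (∨-identityʳ (p 0))
  ⋁-select (suc n) {suc u} p (s≤s u<n) = ⋁-select n (λ i → p (suc i)) u<n

  any-++ : ∀ {A : Set} (p : A → Bool) xs ys → any p (xs ++ ys) ≡ any p xs ∨ any p ys
  any-++ p []       ys = refl
  any-++ p (x ∷ xs) ys = trans (cong (p x ∨_) (any-++ p xs ys)) (sym (∨-assoc (p x) _ _))

  any-concatMap : ∀ {A B : Set} (p : B → Bool) (f : A → List B) xs →
    any p (concatMap f xs) ≡ any (λ x → any p (f x)) xs
  any-concatMap p f []       = refl
  any-concatMap p f (x ∷ xs) =
    trans (any-++ p (f x) (concatMap f xs)) (cong (any p (f x) ∨_) (any-concatMap p f xs))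

  any-zip-applyUpTo : ∀ (p : ℕ × (ℕ × ℕ) → Bool) (g : ℕ → ℕ) E →
    any p (zip (applyUpTo g (length E)) E) ≡ ⋁[ i < length E ] p (g i , E ! i)
  any-zip-applyUpTo p g []      = refl
  any-zip-applyUpTo p g (e ∷ E) = cong (p (g 0 , e) ∨_) (any-zip-applyUpTo p (λ i → g (suc i)) E)

  any-concatMap-indexed : ∀ {A : Set} (p : A → Bool) (f : ℕ × (ℕ × ℕ) → List A) E →
    any p (concatMap f (indexed E)) ≡ ⋁[ i < length E ] any p (f (i , E ! i))
  any-concatMap-indexed p f E =
    trans (any-concatMap p f (indexed E)) (any-zip-applyUpTo _ (λ i → i) E)

  <ᵇ-∨-flip : ∀ m n → ((m <ᵇ n) ∨ (n <ᵇ m)) ≡ not (m ≡ᵇ n)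
  <ᵇ-∨-flip zero    zero    = refl
  <ᵇ-∨-flip zero    (suc n) = refl
  <ᵇ-∨-flip (suc m) zero    = refl
  <ᵇ-∨-flip (suc m) (suc n) = <ᵇ-∨-flip m n

  share-sym : ∀ e f → share e f ≡ share f e
  share-sym (a , b) (c , d) = begin
    (a ≡ᵇ c) ∨ (a ≡ᵇ d) ∨ (b ≡ᵇ c) ∨ (b ≡ᵇ d)
      ≡⟨ swap-middle (a ≡ᵇ c) (a ≡ᵇ d) (b ≡ᵇ c) (b ≡ᵇ d) ⟩
    (a ≡ᵇ c) ∨ (b ≡ᵇ c) ∨ (a ≡ᵇ d) ∨ (b ≡ᵇ d)
      ≡⟨ cong₂ _∨_ (≡ᵇ-sym a c) (cong₂ _∨_ (≡ᵇ-sym b c) (cong₂ _∨_ (≡ᵇ-sym a d) (≡ᵇ-sym b d))) ⟩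
    (c ≡ᵇ a) ∨ (c ≡ᵇ b) ∨ (d ≡ᵇ a) ∨ (d ≡ᵇ b) ∎
    where
    open ∨-∧-Solver
    swap-middle : ∀ x y z w → x ∨ y ∨ z ∨ w ≡ x ∨ z ∨ y ∨ w
    swap-middle = solve 4 (λ x y z w → x :+ (y :+ (z :+ w)) := x :+ (z :+ (y :+ w))) refl

  any-joins-singleton : ∀ c u v i j →
    any (joins u v) (if c then (i , j) ∷ [] else [])
      ≡ ((i ≡ᵇ u) ∧ ((j ≡ᵇ v) ∧ c)) ∨ ((i ≡ᵇ v) ∧ ((j ≡ᵇ u) ∧ c))
  any-joins-singleton c u v i j =
    trans (drop-if c) (distribute c (i ≡ᵇ u) (j ≡ᵇ v) (i ≡ᵇ v) (j ≡ᵇ u))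
    where
    drop-if : ∀ c → any (joins u v) (if c then (i , j) ∷ [] else []) ≡ c ∧ joins u v (i , j)
    drop-if true  = ∨-identityʳ (joins u v (i , j))
    drop-if false = refl
    open ∨-∧-Solver
    distribute : ∀ c a b a′ b′ → c ∧ ((a ∧ b) ∨ (a′ ∧ b′)) ≡ (a ∧ (b ∧ c)) ∨ (a′ ∧ (b′ ∧ c))
    distribute = solve 5 (λ c a b a′ b′ →
      c :* ((a :* b) :+ (a′ :* b′)) := (a :* (b :* c)) :+ (a′ :* (b′ :* c))) refl

  adj-L : ∀ H {u v} → u < length (edges H) → v < length (edges H) →
    adj (L H) u v ≡ not (u ≡ᵇ v) ∧ share (edges H ! u) (edges H ! v)
  adj-L H {u} {v} u<M v<M = begin
    adj (L H) u v
      ≡⟨ adj≡any-joins M (edges (L H)) u v ⟩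
    any (joins u v) (edges (L H))
      ≡⟨ trans (any-concatMap-indexed (joins u v) _ E)
               (⋁-cong M (λ j → any-concatMap-indexed (joins u v) _ E)) ⟩
    ⋁[ j < M ] ⋁[ i < M ] any (joins u v) (if c i j then (i , j) ∷ [] else [])
      ≡⟨ ⋁-cong M (λ j → ⋁-cong M (λ i → any-joins-singleton (c i j) u v i j)) ⟩
    ⋁[ j < M ] ⋁[ i < M ] (((i ≡ᵇ u) ∧ ((j ≡ᵇ v) ∧ c i j)) ∨ ((i ≡ᵇ v) ∧ ((j ≡ᵇ u) ∧ c i j)))
      ≡⟨ ⋁-cong M (λ j → trans (⋁-∨ M _ _) (cong₂ _∨_ (⋁-select M _ u<M) (⋁-select M _ v<M))) ⟩
    ⋁[ j < M ] (((j ≡ᵇ v) ∧ c u j) ∨ ((j ≡ᵇ u) ∧ c v j))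
      ≡⟨ trans (⋁-∨ M _ _) (cong₂ _∨_ (⋁-select M _ v<M) (⋁-select M _ u<M)) ⟩
    ((u <ᵇ v) ∧ share eᵤ eᵥ) ∨ ((v <ᵇ u) ∧ share eᵥ eᵤ)
      ≡⟨ cong (λ s → ((u <ᵇ v) ∧ share eᵤ eᵥ) ∨ ((v <ᵇ u) ∧ s)) (share-sym eᵥ eᵤ) ⟩
    ((u <ᵇ v) ∧ share eᵤ eᵥ) ∨ ((v <ᵇ u) ∧ share eᵤ eᵥ)
      ≡⟨ ∧-distribʳ-∨ (share eᵤ eᵥ) (u <ᵇ v) (v <ᵇ u) ⟨
    ((u <ᵇ v) ∨ (v <ᵇ u)) ∧ share eᵤ eᵥ
      ≡⟨ cong (_∧ share eᵤ eᵥ) (<ᵇ-∨-flip u v) ⟩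
    not (u ≡ᵇ v) ∧ share eᵤ eᵥ ∎
    where
    E = edges H
    M = length E
    eᵤ = E ! u
    eᵥ = E ! v
    c : ℕ → ℕ → Bool
    c i j = (i <ᵇ j) ∧ share (E ! i) (E ! j)

  L-loopless : ∀ H → Loopless (L H)
  L-loopless H v v<M =
    trans (adj-L H v<M v<M) (cong (λ b → not b ∧ share (edges H ! v) (edges H ! v)) (≡ᵇ-refl v))

module Subdivisions where
  open Counting
  open EdgeLists using (_!_)
  open Graphs using (deg≡∑)
  open LineGraphs using (adj-L)
  open import Data.Bool using (Bool; true; false; _∧_; _∨_; not)
  open import Data.Bool.Properties using (∨-identityʳ; ∨-zeroʳ; ∧-identityʳ)
  open import Data.List using (List; []; _∷_; concatMap; applyUpTo; zip; length)
  open import Data.Nat using (ℕ; zero; suc; _+_; _*_; _≤_; _<_; _≡ᵇ_; _≟_; ⌊_/2⌋; s≤s; z≤n)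
  open import Data.Nat.Properties
    using (+-assoc; *-suc; <-≤-trans; m≤m+n; <⇒≢; >⇒≢; n<1+n; m≤n⇒m≤1+n)
  open import Data.Product using (_×_; _,_; proj₁; proj₂)
  open import Function using (_∘_)
  open import Relation.Binary.PropositionalEquality
  open import Relation.Nullary using (yes; no)
  open ≡-Reasoning

  double : ℕ → ℕ
  double zero    = 0
  double (suc n) = suc (suc (double n))

  -- The vertices of L (S H) are the edges of S H; halfEdge i s is the one joining endpoint s of
  -- the i-th edge of H to the vertex subdividing that edge.
  halfEdge : ℕ → Bool → ℕ
  halfEdge i false = double i
  halfEdge i true  = suc (double i)

  endpoint : Bool → ℕ × ℕ → ℕ
  endpoint false = proj₁
  endpoint true  = proj₂

  double≡2* : ∀ n → double n ≡ 2 * n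
  double≡2* zero    = refl
  double≡2* (suc n) = trans (cong (2 +_) (double≡2* n)) (sym (*-suc 2 n))

  double-mono-≤ : ∀ {m n} → m ≤ n → double m ≤ double n
  double-mono-≤ z≤n       = z≤n
  double-mono-≤ (s≤s m≤n) = s≤s (s≤s (double-mono-≤ m≤n))

  ⌊halfEdge/2⌋ : ∀ i s → ⌊ halfEdge i s /2⌋ ≡ i
  ⌊halfEdge/2⌋ zero    false = refl
  ⌊halfEdge/2⌋ zero    true  = refl
  ⌊halfEdge/2⌋ (suc i) false = cong suc (⌊halfEdge/2⌋ i false)
  ⌊halfEdge/2⌋ (suc i) true  = cong suc (⌊halfEdge/2⌋ i true)

  halfEdge-injectiveˡ : ∀ {i j} s t → halfEdge i s ≡ halfEdge j t → i ≡ j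
  halfEdge-injectiveˡ {i} {j} s t eq =
    trans (sym (⌊halfEdge/2⌋ i s)) (trans (cong ⌊_/2⌋ eq) (⌊halfEdge/2⌋ j t))

  halfEdge<double : ∀ {i n} s → i < n → halfEdge i s < double n
  halfEdge<double false (s≤s i≤n) = s≤s (m≤n⇒m≤1+n (double-mono-≤ i≤n))
  halfEdge<double true  (s≤s i≤n) = s≤s (s≤s (double-mono-≤ i≤n))

  ∑-halfEdges : ∀ n (f : ℕ → ℕ) →
    ∑ (double n) f ≡ ∑[ i < n ] (f (halfEdge i false) + f (halfEdge i true))
  ∑-halfEdges zero    f = refl
  ∑-halfEdges (suc n) f =
    trans (+-assoc (∑ (double n) f) _ _)
          (cong (_+ (f (double n) + f (suc (double n)))) (∑-halfEdges n f))

  record ProperEdge (N : ℕ) (e : ℕ × ℕ) : Set where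
    field
      fst<N   : proj₁ e < N
      snd<N   : proj₂ e < N
      fst≢snd : proj₁ e ≢ proj₂ e

  ProperEdges : Graph → Set
  ProperEdges H = ∀ i → i < length (edges H) → ProperEdge (order H) (edges H ! i)

  endpoint<N : ∀ {N e} → ProperEdge N e → ∀ s → endpoint s e < N
  endpoint<N p false = ProperEdge.fst<N p
  endpoint<N p true  = ProperEdge.snd<N p

  endpointSum : List (ℕ × ℕ) → (ℕ → ℕ) → ℕ
  endpointSum E F = ∑[ i < length E ] (F (proj₁ (E ! i)) + F (proj₂ (E ! i)))

  incidences : List (ℕ × ℕ) → ℕ → ℕ
  incidences E a = endpointSum E (λ x → ⟦ x ≡ᵇ a ⟧)

  subdivided : ℕ → ℕ × (ℕ × ℕ) → List (ℕ × ℕ)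
  subdivided N (i , (a , b)) = (a , N + i) ∷ (b , N + i) ∷ []

  length-subdivided : ∀ N (g : ℕ → ℕ) E →
    length (concatMap (subdivided N) (zip (applyUpTo g (length E)) E)) ≡ double (length E)
  length-subdivided N g []      = refl
  length-subdivided N g (e ∷ E) =
    cong (λ n → suc (suc n)) (length-subdivided N (λ i → g (suc i)) E)

  subdivided-! : ∀ N (g : ℕ → ℕ) E {i} s → i < length E →
    concatMap (subdivided N) (zip (applyUpTo g (length E)) E) ! halfEdge i s
      ≡ (endpoint s (E ! i) , N + g i)
  subdivided-! N g (e ∷ E) {zero}  false _         = refl
  subdivided-! N g (e ∷ E) {zero}  true  _         = refl
  subdivided-! N g (e ∷ E) {suc i} false (s≤s i<n) = subdivided-! N (λ i → g (suc i)) E false i<n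
  subdivided-! N g (e ∷ E) {suc i} true  (s≤s i<n) = subdivided-! N (λ i → g (suc i)) E true i<n

  length-S : ∀ H → length (edges (S H)) ≡ double (length (edges H))
  length-S H = length-subdivided (order H) (λ i → i) (edges H)

  S-! : ∀ H {i} s → i < length (edges H) →
    edges (S H) ! halfEdge i s ≡ (endpoint s (edges H ! i) , order H + i)
  S-! H = subdivided-! (order H) (λ i → i) (edges H)

  halfEdge<order : ∀ H {i} s → i < length (edges H) → halfEdge i s < order (L (S H))
  halfEdge<order H s i<M = subst (_ <_) (sym (length-S H)) (halfEdge<double s i<M)

  share-halfEdges : ∀ {N x y} i j → x < N → y < N →
    share (x , N + i) (y , N + j) ≡ (x ≡ᵇ y) ∨ (i ≡ᵇ j)
  share-halfEdges {N} i j x<N y<N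
    rewrite ≢⇒≡ᵇ-false (<⇒≢ (<-≤-trans x<N (m≤m+n N j)))
          | ≢⇒≡ᵇ-false (>⇒≢ (<-≤-trans y<N (m≤m+n N i)))
          | +-cancelˡ-≡ᵇ N i j
          = refl

  module _ (H : Graph) (proper : ProperEdges H) where
    private
      E = edges H
      M = length E
      G = L (S H)

    adj-L-S : ∀ {i j} s t → i < M → j < M →
      adj G (halfEdge i s) (halfEdge j t)
        ≡ not (halfEdge i s ≡ᵇ halfEdge j t) ∧ ((endpoint s (E ! i) ≡ᵇ endpoint t (E ! j)) ∨ (i ≡ᵇ j))
    adj-L-S {i} {j} s t i<M j<M
      rewrite adj-L (S H) (halfEdge<order H s i<M) (halfEdge<order H t j<M)
            | S-! H s i<M
            | S-! H t j<M
            = cong (not (halfEdge i s ≡ᵇ halfEdge j t) ∧_)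
                   (share-halfEdges i j (endpoint<N (proper i i<M) s) (endpoint<N (proper j j<M) t))

    adj-L-S-≢ : ∀ {i j} s t → i < M → j < M → i ≢ j →
      adj G (halfEdge i s) (halfEdge j t) ≡ (endpoint s (E ! i) ≡ᵇ endpoint t (E ! j))
    adj-L-S-≢ s t i<M j<M i≢j
      rewrite adj-L-S s t i<M j<M
            | ≢⇒≡ᵇ-false (i≢j ∘ halfEdge-injectiveˡ s t)
            | ≢⇒≡ᵇ-false i≢j
            = ∨-identityʳ _

    adj-L-S-≡ : ∀ {i} s t → i < M → adj G (halfEdge i s) (halfEdge i t) ≡ not (halfEdge i s ≡ᵇ halfEdge i t)
    adj-L-S-≡ {i} s t i<M
      rewrite adj-L-S s t i<M i<M
            | ≡ᵇ-refl i
            | ∨-zeroʳ (endpoint s (E ! i) ≡ᵇ endpoint t (E ! i))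
            = ∧-identityʳ _

    -- For i = j both sides are 1: on the left only the twin of halfEdge j t is adjacent to it,
    -- on the right only endpoint t itself is counted, the two ends of edge j being distinct.
    deg-L-S-summand : ∀ {i j} t → i < M → j < M →
      ⟦ adj G (halfEdge i false) (halfEdge j t) ⟧ + ⟦ adj G (halfEdge i true) (halfEdge j t) ⟧
        ≡ ⟦ proj₁ (E ! i) ≡ᵇ endpoint t (E ! j) ⟧ + ⟦ proj₂ (E ! i) ≡ᵇ endpoint t (E ! j) ⟧
    deg-L-S-summand {i} {j} t i<M j<M with i ≟ j
    ... | no i≢j =
      cong₂ _+_ (cong ⟦_⟧ (adj-L-S-≢ false t i<M j<M i≢j)) (cong ⟦_⟧ (adj-L-S-≢ true t i<M j<M i≢j))
    ... | yes refl =
      trans (cong₂ _+_ (cong ⟦_⟧ (adj-L-S-≡ false t i<M)) (cong ⟦_⟧ (adj-L-S-≡ true t i<M))) (ends t)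
      where
      x₀≢x₁ = ProperEdge.fst≢snd (proper i i<M)
      ends : ∀ t →
        ⟦ not (halfEdge i false ≡ᵇ halfEdge i t) ⟧ + ⟦ not (halfEdge i true ≡ᵇ halfEdge i t) ⟧
          ≡ ⟦ proj₁ (E ! i) ≡ᵇ endpoint t (E ! i) ⟧ + ⟦ proj₂ (E ! i) ≡ᵇ endpoint t (E ! i) ⟧
      ends false
        rewrite ≡ᵇ-refl (double i) | ≢⇒≡ᵇ-false (>⇒≢ (n<1+n (double i)))
              | ≡ᵇ-refl (proj₁ (E ! i)) | ≢⇒≡ᵇ-false (x₀≢x₁ ∘ sym)
              = refl
      ends true
        rewrite ≡ᵇ-refl (suc (double i)) | ≢⇒≡ᵇ-false (<⇒≢ (n<1+n (double i)))
              | ≡ᵇ-refl (proj₂ (E ! i)) | ≢⇒≡ᵇ-false x₀≢x₁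
              = refl

    deg-L-S : ∀ {j} t → j < M → deg G (halfEdge j t) ≡ incidences E (endpoint t (E ! j))
    deg-L-S {j} t j<M = begin
      deg G v
        ≡⟨ deg≡∑ G v ⟩
      ∑[ u < length (edges (S H)) ] ⟦ adj G u v ⟧
        ≡⟨ cong (λ n → ∑[ u < n ] ⟦ adj G u v ⟧) (length-S H) ⟩
      ∑[ u < double M ] ⟦ adj G u v ⟧
        ≡⟨ ∑-halfEdges M _ ⟩
      ∑[ i < M ] (⟦ adj G (halfEdge i false) v ⟧ + ⟦ adj G (halfEdge i true) v ⟧)
        ≡⟨ ∑-cong M (λ i i<M → deg-L-S-summand t i<M j<M) ⟩
      incidences E (endpoint t (E ! j)) ∎
      where
      v = halfEdge j t

    ∑-deg-L-S : ∀ (g : ℕ → ℕ) → ∑[ v < order G ] g (deg G v) ≡ endpointSum E (λ a → g (incidences E a))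
    ∑-deg-L-S g = begin
      ∑[ v < length (edges (S H)) ] g (deg G v)
        ≡⟨ cong (λ n → ∑[ v < n ] g (deg G v)) (length-S H) ⟩
      ∑[ v < double M ] g (deg G v)
        ≡⟨ ∑-halfEdges M _ ⟩
      ∑[ i < M ] (g (deg G (halfEdge i false)) + g (deg G (halfEdge i true)))
        ≡⟨ ∑-cong M (λ i i<M → cong₂ _+_ (cong g (deg-L-S false i<M)) (cong g (deg-L-S true i<M))) ⟩
      endpointSum E (λ a → g (incidences E a)) ∎

module CycleStars where
  open Counting
  open EdgeLists
  open Subdivisions using (ProperEdge; ProperEdges; endpointSum; incidences; ∑-deg-L-S)
  open import Data.Bool using (if_then_else_)
  open import Data.List using (map; upTo; length)
  open import Data.List.Properties using (length-++)
  open import Data.Nat using (ℕ; suc; _+_; _*_; _∸_; _≤_; _<_; _<?_; _≡ᵇ_; s≤s; z≤n)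
  open import Data.Nat.Properties
  open import Data.Nat.Tactic.RingSolver using (solve-∀)
  open import Data.Product using (Σ-syntax; _×_; _,_)
  open import Data.Sum using (_⊎_; inj₁; inj₂)
  open import Relation.Binary.PropositionalEquality
  open import Relation.Nullary using (yes; no)
  open ≡-Reasoning

  cycleNext-< : ∀ k' {i} → i < k' → cycleNext (suc k') i ≡ suc i
  cycleNext-< k' {i} i<k' = cong (λ b → if b then 0 else suc i) (≢⇒≡ᵇ-false (<⇒≢ i<k'))

  cycleNext-last : ∀ k' → cycleNext (suc k') k' ≡ 0
  cycleNext-last k' = cong (λ b → if b then 0 else suc k') (≡ᵇ-refl k')

  ∑-cycleNext : ∀ k' (F : ℕ → ℕ) → ∑[ i < suc k' ] F (cycleNext (suc k') i) ≡ ∑ (suc k') F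
  ∑-cycleNext k' F = begin
    ∑[ i < k' ] F (cycleNext (suc k') i) + F (cycleNext (suc k') k')
      ≡⟨ cong₂ _+_ (∑-cong k' (λ i i<k' → cong F (cycleNext-< k' i<k'))) (cong F (cycleNext-last k')) ⟩
    ∑[ i < k' ] F (suc i) + F 0
      ≡⟨ +-comm _ (F 0) ⟩
    F 0 + ∑[ i < k' ] F (suc i)
      ≡⟨ ∑-suc k' F ⟨
    ∑ (suc k') F ∎

  length-CS : ∀ k m → length (edges (CS k m)) ≡ k + m
  length-CS k m =
    trans (length-++ (map _ (upTo k))) (cong₂ _+_ (length-map-upTo _ k) (length-map-upTo _ m))

  CS-cycle-edge : ∀ {k} m {i} → i < k → edges (CS k m) ! i ≡ (i , cycleNext k i)
  CS-cycle-edge {k} m {i} i<k =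
    trans (!-++ˡ (map _ (upTo k)) _ (subst (i <_) (sym (length-map-upTo _ k)) i<k)) (map-upTo-! _ i<k)

  CS-pendant-edge : ∀ k {m l} → l < m → edges (CS k m) ! (k + l) ≡ (0 , k + l)
  CS-pendant-edge k {m} {l} l<m = begin
    edges (CS k m) ! (k + l)
      ≡⟨ cong (λ n → edges (CS k m) ! (n + l)) (length-map-upTo _ k) ⟨
    edges (CS k m) ! (length (map _ (upTo k)) + l)
      ≡⟨ !-++ʳ (map _ (upTo k)) _ l ⟩
    map _ (upTo m) ! l
      ≡⟨ map-upTo-! _ l<m ⟩
    (0 , k + l) ∎

  module _ (k' m : ℕ) where
    private
      k = suc k'
      E = edges (CS k m)

    endpointSum-CS : ∀ (F : ℕ → ℕ) → endpointSum E F ≡ ∑ k F + ∑ k F + ∑[ l < m ] (F 0 + F (k + l))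
    endpointSum-CS F = begin
      ∑[ i < length E ] ends (E ! i)
        ≡⟨ cong (λ n → ∑[ i < n ] ends (E ! i)) (length-CS k m) ⟩
      ∑[ i < k + m ] ends (E ! i)
        ≡⟨ ∑-split k m (λ i → ends (E ! i)) ⟩
      ∑[ i < k ] ends (E ! i) + ∑[ l < m ] ends (E ! (k + l))
        ≡⟨ cong₂ _+_ (∑-cong k (λ i i<k → cong ends (CS-cycle-edge m i<k)))
                     (∑-cong m (λ l l<m → cong ends (CS-pendant-edge k l<m))) ⟩
      ∑[ i < k ] (F i + F (cycleNext k i)) + ∑[ l < m ] (F 0 + F (k + l))
        ≡⟨ cong (_+ ∑[ l < m ] (F 0 + F (k + l)))
                (trans (∑-+ k F _) (cong (∑ k F +_) (∑-cycleNext k' F))) ⟩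
      ∑ k F + ∑ k F + ∑[ l < m ] (F 0 + F (k + l)) ∎
      where
      ends : ℕ × ℕ → ℕ
      ends (a , b) = F a + F b

    incidences-hub : incidences E 0 ≡ 2 + m
    incidences-hub = begin
      incidences E 0
        ≡⟨ endpointSum-CS _ ⟩
      ∑[ i < k ] ⟦ i ≡ᵇ 0 ⟧ + ∑[ i < k ] ⟦ i ≡ᵇ 0 ⟧ + ∑[ l < m ] 1
        ≡⟨ cong₂ _+_ (cong₂ _+_ (∑-⟦≡ᵇ⟧-< k (s≤s z≤n)) (∑-⟦≡ᵇ⟧-< k (s≤s z≤n))) (∑-const m 1) ⟩
      2 + m * 1
        ≡⟨ cong (2 +_) (*-identityʳ m) ⟩
      2 + m ∎

    incidences-cycle : ∀ {a} → a < k' → incidences E (suc a) ≡ 2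
    incidences-cycle {a} a<k' = begin
      incidences E (suc a)
        ≡⟨ endpointSum-CS _ ⟩
      ∑[ i < k ] ⟦ i ≡ᵇ suc a ⟧ + ∑[ i < k ] ⟦ i ≡ᵇ suc a ⟧ + ∑[ l < m ] ⟦ k' + l ≡ᵇ a ⟧
        ≡⟨ cong₂ _+_ (cong₂ _+_ (∑-⟦≡ᵇ⟧-< k (s≤s a<k')) (∑-⟦≡ᵇ⟧-< k (s≤s a<k'))) no-pendant ⟩
      2 ∎
      where
      no-pendant : ∑[ l < m ] ⟦ k' + l ≡ᵇ a ⟧ ≡ 0
      no-pendant = trans (∑-cong m (λ l _ → cong ⟦_⟧ (≢⇒≡ᵇ-false (>⇒≢ (<-≤-trans a<k' (m≤m+n k' l))))))
                         (trans (∑-const m 0) (*-zeroʳ m))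

    incidences-pendant : ∀ {l} → l < m → incidences E (k + l) ≡ 1
    incidences-pendant {l} l<m = begin
      incidences E (k + l)
        ≡⟨ endpointSum-CS _ ⟩
      ∑[ i < k ] ⟦ i ≡ᵇ k + l ⟧ + ∑[ i < k ] ⟦ i ≡ᵇ k + l ⟧ + ∑[ j < m ] ⟦ k + j ≡ᵇ k + l ⟧
        ≡⟨ cong₂ _+_ (cong₂ _+_ (∑-⟦≡ᵇ⟧-≥ k (m≤m+n k l)) (∑-⟦≡ᵇ⟧-≥ k (m≤m+n k l)))
                     (trans (∑-cong m (λ j _ → cong ⟦_⟧ (+-cancelˡ-≡ᵇ k j l))) (∑-⟦≡ᵇ⟧-< m l<m)) ⟩
      1 ∎

  ProperEdge-weaken : ∀ {N N′ e} → N ≤ N′ → ProperEdge N e → ProperEdge N′ e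
  ProperEdge-weaken N≤N′ p = record
    { fst<N   = <-≤-trans (ProperEdge.fst<N p) N≤N′
    ; snd<N   = <-≤-trans (ProperEdge.snd<N p) N≤N′
    ; fst≢snd = ProperEdge.fst≢snd p
    }

  cycle-edge-proper : ∀ {k' i} → 1 ≤ k' → i < suc k' → ProperEdge (suc k') (i , cycleNext (suc k') i)
  cycle-edge-proper {k'} {i} 1≤k' (s≤s i≤k') with m≤n⇒m<n∨m≡n i≤k'
  ... | inj₁ i<k' rewrite cycleNext-< k' i<k' =
    record { fst<N = s≤s i≤k' ; snd<N = s≤s i<k' ; fst≢snd = <⇒≢ (n<1+n i) }
  ... | inj₂ refl rewrite cycleNext-last k' =
    record { fst<N = n<1+n k' ; snd<N = s≤s z≤n ; fst≢snd = >⇒≢ 1≤k' }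

  split-index : ∀ k {m i} → i < k + m → i < k ⊎ Σ[ l ∈ ℕ ] (l < m × i ≡ k + l)
  split-index k {m} {i} i<k+m with i <? k
  ... | yes i<k = inj₁ i<k
  ... | no  i≮k = inj₂ (i ∸ k , +-cancelˡ-< k _ _ (subst (_< k + m) i≡k+l i<k+m) , i≡k+l)
    where
    i≡k+l : i ≡ k + (i ∸ k)
    i≡k+l = sym (m+[n∸m]≡n (≮⇒≥ i≮k))

  CS-proper : ∀ k' m → 1 ≤ k' → ProperEdges (CS (suc k') m)
  CS-proper k' m 1≤k' i i<k+m with split-index (suc k') (subst (i <_) (length-CS (suc k') m) i<k+m)
  ... | inj₁ i<k rewrite CS-cycle-edge m i<k =
    ProperEdge-weaken (m≤m+n (suc k') m) (cycle-edge-proper 1≤k' i<k)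
  ... | inj₂ (l , l<m , refl) rewrite CS-pendant-edge (suc k') l<m =
    record { fst<N = s≤s z≤n ; snd<N = +-monoʳ-< (suc k') l<m ; fst≢snd = λ () }

  ∑-deg-LSCS : ∀ k' m → 1 ≤ k' → (g : ℕ → ℕ) → let G = L (S (CS (suc k') m)) in
    ∑[ v < order G ] g (deg G v) ≡ (2 + m) * g (2 + m) + 2 * k' * g 2 + m * g 1
  ∑-deg-LSCS k' m 1≤k' g = begin
    _ ≡⟨ ∑-deg-L-S (CS k m) (CS-proper k' m 1≤k') g ⟩
    endpointSum E (λ a → g (incidences E a))
      ≡⟨ endpointSum-CS k' m _ ⟩
    cycleSum + cycleSum + ∑[ l < m ] (g (incidences E 0) + g (incidences E (k + l)))
      ≡⟨ cong₂ _+_ (cong₂ _+_ cycleSum≡ cycleSum≡) pendantSum≡ ⟩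
    (g (2 + m) + k' * g 2) + (g (2 + m) + k' * g 2) + m * (g (2 + m) + g 1)
      ≡⟨ regroup k' m (g (2 + m)) (g 2) (g 1) ⟩
    (2 + m) * g (2 + m) + 2 * k' * g 2 + m * g 1 ∎
    where
    k = suc k'
    E = edges (CS k m)
    cycleSum : ℕ
    cycleSum = ∑[ a < k ] g (incidences E a)
    cycleSum≡ : cycleSum ≡ g (2 + m) + k' * g 2
    cycleSum≡ = trans (∑-suc k' _) (cong₂ _+_ (cong g (incidences-hub k' m))
      (trans (∑-cong k' (λ a a<k' → cong g (incidences-cycle k' m a<k'))) (∑-const k' (g 2))))
    pendantSum≡ : ∑[ l < m ] (g (incidences E 0) + g (incidences E (k + l))) ≡ m * (g (2 + m) + g 1)
    pendantSum≡ = trans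
      (∑-cong m (λ l l<m → cong₂ _+_ (cong g (incidences-hub k' m)) (cong g (incidences-pendant k' m l<m))))
      (∑-const m _)
    regroup : ∀ c p x y z → (x + c * y) + (x + c * y) + p * (x + z) ≡ (2 + p) * x + 2 * c * y + p * z
    regroup = solve-∀

open Graphs using (Loopless; degSum; M1; coM1+M1+degSum≡order*degSum)
open LineGraphs using (L-loopless)
open Subdivisions using (double≡2*; length-S)
open CycleStars using (length-CS; ∑-deg-LSCS)

open import Data.Integer using (ℤ; +_; _+_; _-_; _*_)
open import Data.Integer.Properties using (pos-*)
open import Data.Integer.Tactic.RingSolver using (solve-∀)
open import Data.Nat as ℕ using (ℕ; suc; _≤_; _∸_; s≤s)
open import Data.Nat.Properties using (m+[n∸m]≡n; m∸n≢0⇒n<m; >⇒≢; <⇒≤)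
open import Relation.Binary.PropositionalEquality

+coM1≡order*degSum-M1-degSum : ∀ G → Loopless G →
  + coM1 G ≡ + order G * + degSum G - + M1 G - + degSum G
+coM1≡order*degSum-M1-degSum G loopless = begin
  + coM1 G
    ≡⟨ cancel (+ coM1 G) (+ M1 G) (+ degSum G) ⟩
  + (coM1 G ℕ.+ M1 G ℕ.+ degSum G) - + M1 G - + degSum G
    ≡⟨ cong (λ x → + x - + M1 G - + degSum G) (coM1+M1+degSum≡order*degSum G loopless) ⟩
  + (order G ℕ.* degSum G) - + M1 G - + degSum G
    ≡⟨ cong (λ x → x - + M1 G - + degSum G) (pos-* (order G) (degSum G)) ⟩
  + order G * + degSum G - + M1 G - + degSum G ∎
  where
  open ≡-Reasoning
  cancel : ∀ x y z → x ≡ x + y + z - y - z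
  cancel = solve-∀

pos-degreeSequence : ∀ k' m x y z →
  + ((2 ℕ.+ m) ℕ.* x ℕ.+ 2 ℕ.* k' ℕ.* y ℕ.+ m ℕ.* z)
    ≡ (+ 2 + + m) * + x + + 2 * + k' * + y + + m * + z
pos-degreeSequence k' m x y z = cong₂ _+_
  (cong₂ _+_ (pos-* (2 ℕ.+ m) x) (trans (pos-* (2 ℕ.* k') y) (cong (_* + y) (pos-* 2 k'))))
  (pos-* m z)

module _ (k' m : ℕ) where
  private
    G = L (S (CS (suc k') m))
    n Σd Σd² : ℤ
    n   = + suc k' + + m
    Σd  = (+ 2 + + m) * (+ 2 + + m) + + 2 * + k' * + 2 + + m * + 1
    Σd² = (+ 2 + + m) * ((+ 2 + + m) * (+ 2 + + m)) + + 2 * + k' * + 4 + + m * + 1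

  +order-LSCS : + order G ≡ + 2 * n
  +order-LSCS = trans
    (cong +_ (trans (length-S (CS (suc k') m)) (trans (double≡2* _) (cong (2 ℕ.*_) (length-CS (suc k') m)))))
    (pos-* 2 (suc k' ℕ.+ m))

  +degSum-LSCS : 1 ≤ k' → + degSum G ≡ Σd
  +degSum-LSCS 1≤k' =
    trans (cong +_ (∑-deg-LSCS k' m 1≤k' (λ d → d))) (pos-degreeSequence k' m (2 ℕ.+ m) 2 1)

  +M1-LSCS : 1 ≤ k' → + M1 G ≡ Σd²
  +M1-LSCS 1≤k' = trans (cong +_ (∑-deg-LSCS k' m 1≤k' (λ d → d ℕ.* d)))
    (trans (pos-degreeSequence k' m ((2 ℕ.+ m) ℕ.* (2 ℕ.+ m)) 4 1)
           (cong (λ x → (+ 2 + + m) * x + + 2 * + k' * + 4 + + m * + 1) (pos-* (2 ℕ.+ m) (2 ℕ.+ m))))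

  +coM1-LSCS : 1 ≤ k' → + coM1 G ≡ + 2 * n * Σd - Σd² - Σd
  +coM1-LSCS 1≤k' = begin
    + coM1 G
      ≡⟨ +coM1≡order*degSum-M1-degSum G (L-loopless (S (CS (suc k') m))) ⟩
    + order G * + degSum G - + M1 G - + degSum G
      ≡⟨ cong₂ (λ V d → V * d - + M1 G - d) +order-LSCS (+degSum-LSCS 1≤k') ⟩
    + 2 * n * Σd - + M1 G - Σd
      ≡⟨ cong (λ q → + 2 * n * Σd - q - Σd) (+M1-LSCS 1≤k') ⟩
    + 2 * n * Σd - Σd² - Σd ∎
    where open ≡-Reasoning

coM1-polynomial : ∀ (k' m : ℤ) →
  let k   = + 1 + k'
      n   = k + m
      Σd  = (+ 2 + m) * (+ 2 + m) + + 2 * k' * + 2 + m * + 1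
      Σd² = (+ 2 + m) * ((+ 2 + m) * (+ 2 + m)) + + 2 * k' * + 4 + m * + 1
  in  + 2 * n * Σd - Σd² - Σd
        ≡ n * n * n + (+ 3 - k) * n * n - (k * k - + 12 * k + + 18) * n
          + k * k * k - + 7 * k * k + + 6 * k
coM1-polynomial = solve-∀

theorem2p4 : (k n : ℕ) → 3 ≤ k → 1 ≤ n ∸ k →
    + coM1 (L (S (CS k (n ∸ k))))
    ≡ (+ n) * (+ n) * (+ n) + (+ 3 - + k) * (+ n) * (+ n)
    - ((+ k) * (+ k) - + 12 * + k + + 18) * (+ n)
    + (+ k) * (+ k) * (+ k) - + 7 * (+ k) * (+ k) + + 6 * + k
theorem2p4 (suc k') n (s≤s 2≤k') 1≤n∸k
  with n ∸ suc k' | m+[n∸m]≡n {suc k'} {n} (<⇒≤ (m∸n≢0⇒n<m (>⇒≢ 1≤n∸k)))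
... | m | refl = trans (+coM1-LSCS k' m (<⇒≤ 2≤k')) (coM1-polynomial (+ k') (+ m))
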